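{- Let $u,v$ be factors of the Zimin word $Z$ with $k(u)<k(v)$, written $u=u_{A_1}x_{k(u)}v_{B_1}$ and $v=u_{A_2}x_{k(v)}v_{B_2}$ with $A_1,B_1\subset[1,k(u)[$ and $A_2,B_2\subset[1,k(v)[$. Then: (1) $uv$ is a factor of $Z$ if and only if $k(u)\notin A_2$ and $B_1=[1,k(u)[\setminus(A_2\cap[1,k(u)[)$; (2) if $uv$ is a factor of $Z$, then $uv=u_{A_1\cup\{k(u)\}\cup(A_2\cap]k(u),k(v)[)}\,x_{k(v)}\,v_{B_2}$; (3) $u$ is a suffix of $v$ if and only if $k(u)\in B_2$ and $B_2\cap[1,k(u)[=B_1$.
   Context: Alphabet $\{x_1,x_2,\ldots\}$; $Z_1=x_1$, $Z_{m+1}=Z_mx_{m+1}Z_m$, $Z=\lim Z_m$. For a factor $w$ of $Z$, $k(w)=\max\{k: x_k\text{ occurs in }w\}$. $u_1=v_1=x_1$, $u_{m+1}=x_{m+1}u_1\cdots u_m$, $v_{m+1}=v_m\cdots v_1x_{m+1}$. $[a,b[=\{a,\ldots,b-1\}$, $]a,b[=\{a+1,\ldots,b-1\}$. For finite $A=\{i_1<\cdots<i_k\}$, $u_A=u_{i_1}\cdots u_{i_k}$; for $B=\{j_1<\cdots<j_k\}$, $v_B=v_{j_k}\cdots v_{j_1}$; empty products are empty words. Every factor $w$ of $Z$ can be written uniquely as $w=u_Ax_{k(w)}v_B$ with $A,B\subset[1,k(w)[$. -}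

module Defs where

open import Data.Nat using (ℕ; zero; suc; _≤_; _<_; _⊔_; _≤ᵇ_; _<ᵇ_; _≡ᵇ_)
open import Data.Bool using (Bool; true; false; _∧_; _∨_; not; if_then_else_)
open import Data.List using (List; []; _∷_; _++_; foldr)
open import Data.Product using (Σ; ∃; _×_)
open import Relation.Binary.PropositionalEquality using (_≡_)

-- Letters x_k are represented by the natural number k (k ≥ 1); words are lists.
Word : Set
Word = List ℕ

Z : ℕ → Word
Z zero    = []
Z (suc m) = Z m ++ (suc m ∷ Z m)

-- w is a factor of the infinite Zimin word Z = lim Z_m
-- (Z_m is a prefix of Z_{m+1}, so factors of Z are the factors of the Z_m).
IsFactorZ : Word → Set
IsFactorZ w = ∃ λ m → ∃ λ p → ∃ λ s → Z m ≡ p ++ (w ++ s)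

IsSuffix : Word → Word → Set
IsSuffix w w' = ∃ λ p → w' ≡ p ++ w

k : Word → ℕ
k = foldr _⊔_ 0

-- u_m and v_m (index 0 is unused and set to the empty word), together with
-- Up m = u_1 ⋯ u_m and Vp m = v_m ⋯ v_1.
mutual
  u : ℕ → Word
  u zero    = []
  u (suc m) = suc m ∷ Up m

  Up : ℕ → Word
  Up zero    = []
  Up (suc m) = Up m ++ u (suc m)

mutual
  v : ℕ → Word
  v zero    = []
  v (suc m) = Vp m ++ (suc m ∷ [])

  Vp : ℕ → Word
  Vp zero    = []
  Vp (suc m) = v (suc m) ++ Vp m

NSet : Set
NSet = ℕ → Bool

inCO : ℕ → ℕ → ℕ → Bool
inCO a b i = (a ≤ᵇ i) ∧ (i <ᵇ b)

inOO : ℕ → ℕ → ℕ → Bool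
inOO a b i = (a <ᵇ i) ∧ (i <ᵇ b)

SubsetCO : NSet → ℕ → Set
SubsetCO A n = ∀ i → A i ≡ true → inCO 1 n i ≡ true

-- u_A = u_{i_1} ⋯ u_{i_k} (increasing order) over the elements of A below n;
-- for A ⊂ [1,n[ this is exactly u_A.
uSet : NSet → ℕ → Word
uSet A zero    = []
uSet A (suc n) = uSet A n ++ (if A n then u n else [])

-- v_B = v_{j_k} ⋯ v_{j_1} (decreasing order) over the elements of B below n.
vSet : NSet → ℕ → Word
vSet B zero    = []
vSet B (suc n) = (if B n then v n else []) ++ vSet B n

rep : NSet → ℕ → NSet → Word
rep A n B = uSet A n ++ (n ∷ vSet B n)

module Submission where

-- In Z_{j+1} = Z_j x_{j+1} Z_j all letters of Z_j are smaller than x_{j+1}, so the largest letter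
-- of a factor of Z occurs in it only once, and a factor u_A x_n v_B of Z sits on an occurrence of
-- x_n with u_A a suffix and v_B a prefix of Z_{n-1}. Hence uv = (u u_{A₂}) x_m v_{B₂} is a factor
-- iff u u_{A₂} is a suffix of Z_{m-1}. As u_i = x_i Z_{i-1} is the right half of Z_i, the factors
-- u_i with i > n can be peeled off one by one, leaving v_{B₁} u_{A₂ ∩ [1,n[} = Z_{n-1} with n ∉ A₂;
-- and since Z_i = v_i Z_{i-1} = Z_{i-1} u_i, the letter x_i of Z_{n-1} must come from exactly one
-- of v_i and u_i, i.e. B₁ and A₂ are complementary in [1,n[. Likewise u is a suffix of v iff it is
-- a suffix of v_{B₂}; peeling off the v_i = Z_{i-1} x_i with i > n leaves v_{B₁} = v_{B₂ ∩ [1,n[}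
-- with n ∈ B₂, and v_B determines B.

open import Defs
open import Data.Nat using (ℕ; zero; suc; _≤_; _<_; _≤′_; ≤′-step; ≤′-refl; _≡ᵇ_; z≤n; s≤s)
open import Data.Nat.Properties
  using (<-≤-trans; ≤-pred; n≤1+n; n<1+n; <-irrefl; <-asym; <⇒≢; <⇒≱; <⇒≤; <-cmp; m<n⇒m<1+n;
         m<1+n⇒m<n∨m≡n; m≤n⇒m≤1+n; ≤-refl; ≤′⇒≤; ≤⇒≤′; ≡ᵇ⇒≡; ≡⇒≡ᵇ; <ᵇ-reflects-<; ≤ᵇ-reflects-≤)
open import Data.Bool using (true; false; _∧_; _∨_; not; if_then_else_)
open import Data.Bool.Properties using (∧-identityʳ; ∧-zeroʳ; ∨-identityʳ; ∨-zeroʳ)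
open import Data.List using ([]; _∷_; _++_)
open import Data.List.Properties using (++-assoc; ++-identityʳ; ++-cancelˡ; ∷-injective)
open import Data.List.Relation.Unary.All as All using (All; []; _∷_)
open import Data.List.Relation.Unary.All.Properties using (++⁺; ++⁻ˡ; ++⁻ʳ)
open import Data.Product using (_×_; _,_; proj₁; proj₂; ∃)
open import Data.Product.Function.NonDependent.Propositional using (_×-⇔_)
open import Data.Sum using (_⊎_; inj₁; inj₂)
open import Data.Empty using (⊥-elim)
open import Function.Base using (_∘_)
open import Function.Bundles using (_⇔_; mk⇔; Equivalence)
open import Function.Properties.Equivalence using (⇔-setoid; ⇔-isEquivalence)
open import Level using (0ℓ)
open import Relation.Binary using (IsEquivalence; tri<; tri≈; tri>)
open import Relation.Binary.PropositionalEquality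
  using (_≡_; refl; sym; trans; cong; cong₂; subst; subst₂; module ≡-Reasoning)
open import Relation.Nullary using (¬_)
open import Relation.Nullary.Reflects using (Reflects; ofʸ; ofⁿ; invert; det; fromEquivalence; _×-reflects_)

import Relation.Binary.Reasoning.Setoid as SetoidReasoning

module ⇔-Reasoning = SetoidReasoning (⇔-setoid 0ℓ)

open IsEquivalence (⇔-isEquivalence {0ℓ}) using () renaming (refl to ⇔-refl; sym to ⇔-sym; trans to ⇔-trans)

Below : ℕ → Word → Set
Below c = All (_< c)

Below-mono : ∀ {c d w} → c ≤ d → Below c w → Below d w
Below-mono c≤d = All.map (λ x<c → <-≤-trans x<c c≤d)

Below-if : ∀ {c w} b → Below c w → Below c (if b then w else [])
Below-if true  w<c = w<c
Below-if false _   = []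

¬Below-max : ∀ {c} xs ys → ¬ Below c (xs ++ c ∷ ys)
¬Below-max xs ys bound with ++⁻ʳ xs bound
... | c<c ∷ _ = <-irrefl refl c<c

Up≡Z : ∀ j → Up j ≡ Z j
Up≡Z zero    = refl
Up≡Z (suc j) = cong₂ (λ X Y → X ++ suc j ∷ Y) (Up≡Z j) (Up≡Z j)

Vp≡Z : ∀ j → Vp j ≡ Z j
v-suc-++ : ∀ j Y → v (suc j) ++ Y ≡ Z j ++ suc j ∷ Y

Vp≡Z zero    = refl
Vp≡Z (suc j) = trans (v-suc-++ j (Vp j)) (cong (λ Y → Z j ++ suc j ∷ Y) (Vp≡Z j))

v-suc-++ j Y = trans (++-assoc (Vp j) (suc j ∷ []) Y) (cong (λ X → X ++ suc j ∷ Y) (Vp≡Z j))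

Z-below : ∀ j → Below (suc j) (Z j)
Z-below zero    = []
Z-below (suc j) = ++⁺ Zj (n<1+n (suc j) ∷ Zj)
  where Zj = Below-mono (n≤1+n (suc j)) (Z-below j)

u-below : ∀ i → Below (suc i) (u i)
u-below zero    = []
u-below (suc i) = n<1+n (suc i) ∷ subst (Below _) (sym (Up≡Z i)) (Below-mono (n≤1+n _) (Z-below i))

v-below : ∀ i → Below (suc i) (v i)
v-below zero    = []
v-below (suc i) =
  ++⁺ (subst (Below _) (sym (Vp≡Z i)) (Below-mono (n≤1+n _) (Z-below i))) (n<1+n (suc i) ∷ [])

uSet-below : ∀ A n → Below n (uSet A n)
uSet-below A zero    = []
uSet-below A (suc n) = ++⁺ (Below-mono (n≤1+n n) (uSet-below A n)) (Below-if (A n) (u-below n))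

vSet-below : ∀ B n → Below n (vSet B n)
vSet-below B zero    = []
vSet-below B (suc n) = ++⁺ (Below-if (B n) (v-below n)) (Below-mono (n≤1+n n) (vSet-below B n))

split-at-max-unique : ∀ {c} a b a′ b′ → Below c a → Below c b →
                      a ++ c ∷ b ≡ a′ ++ c ∷ b′ → a ≡ a′ × b ≡ b′
split-at-max-unique []      b []       b′ _ _ eq = refl , proj₂ (∷-injective eq)
split-at-max-unique []      b (_ ∷ a′) b′ _ b<c eq =
  ⊥-elim (¬Below-max a′ b′ (subst (Below _) (proj₂ (∷-injective eq)) b<c))
split-at-max-unique (_ ∷ a) b []       b′ (x<c ∷ _) _ eq = ⊥-elim (<-irrefl (proj₁ (∷-injective eq)) x<c)
split-at-max-unique (_ ∷ a) b (_ ∷ a′) b′ (_ ∷ a<c) b<c eq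
  with refl , eq′ ← ∷-injective eq
  with refl , refl ← split-at-max-unique a b a′ b′ a<c b<c eq′ = refl , refl

Z-suc-split : ∀ j X Y → Z (suc j) ≡ X ++ suc j ∷ Y → Z j ≡ X × Z j ≡ Y
Z-suc-split j X Y = split-at-max-unique (Z j) (Z j) X Y (Z-below j) (Z-below j)

IsPrefix : Word → Word → Set
IsPrefix w w′ = ∃ λ s → w′ ≡ w ++ s

IsFactor : Word → Word → Set
IsFactor w w′ = ∃ λ p → ∃ λ s → w′ ≡ p ++ (w ++ s)

IsSuffix-++ˡ : ∀ {T Y} X → IsSuffix T Y → IsSuffix T (X ++ Y)
IsSuffix-++ˡ {T} X (p , refl) = X ++ p , sym (++-assoc X p T)

IsSuffix-past-max : ∀ {c T} X Y → Below c T → IsSuffix T (X ++ c ∷ Y) ⇔ IsSuffix T Y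
IsSuffix-past-max {c} X Y T<c = mk⇔ (drop X) (IsSuffix-++ˡ X ∘ IsSuffix-++ˡ (c ∷ []))
  where
  drop : ∀ X → IsSuffix _ (X ++ c ∷ Y) → IsSuffix _ Y
  drop X       ([]    , eq) = ⊥-elim (¬Below-max X Y (subst (Below c) (sym eq) T<c))
  drop []      (_ ∷ p , eq) = p , proj₂ (∷-injective eq)
  drop (_ ∷ X) (_ ∷ p , eq) = drop X (p , proj₂ (∷-injective eq))

IsSuffix-around-max : ∀ {c} U V X Y → Below c X → Below c Y →
                      IsSuffix (U ++ c ∷ V) (X ++ c ∷ Y) ⇔ (IsSuffix U X × V ≡ Y)
IsSuffix-around-max {c} U V X Y X<c Y<c = mk⇔ to from
  where
  to : IsSuffix (U ++ c ∷ V) (X ++ c ∷ Y) → IsSuffix U X × V ≡ Y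
  to (p , eq) with split-at-max-unique X Y (p ++ U) V X<c Y<c (trans eq (sym (++-assoc p U (c ∷ V))))
  ... | X≡pU , Y≡V = (p , X≡pU) , sym Y≡V
  from : IsSuffix U X × V ≡ Y → IsSuffix (U ++ c ∷ V) (X ++ c ∷ Y)
  from ((p , refl) , refl) = p , ++-assoc p U (c ∷ V)

++-around : ∀ (p L : Word) c (R s : Word) → p ++ ((L ++ c ∷ R) ++ s) ≡ (p ++ L) ++ c ∷ (R ++ s)
++-around p L c R s = begin
  p ++ ((L ++ c ∷ R) ++ s)  ≡⟨ cong (p ++_) (++-assoc L (c ∷ R) s) ⟩
  p ++ (L ++ c ∷ (R ++ s))  ≡⟨ ++-assoc p L (c ∷ (R ++ s)) ⟨
  (p ++ L) ++ c ∷ (R ++ s)  ∎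
  where open ≡-Reasoning

prefix-before-max : ∀ {d} W {s} X {Y} → Below d W → X ++ d ∷ Y ≡ W ++ s → IsPrefix W X
prefix-before-max []      X       _          _  = X , refl
prefix-before-max (w ∷ W) []      (w<d ∷ _) eq = ⊥-elim (<-irrefl (sym (proj₁ (∷-injective eq))) w<d)
prefix-before-max (w ∷ W) (_ ∷ X) (_ ∷ W<d) eq with refl , eq′ ← ∷-injective eq =
  let s′ , X≡Ws′ = prefix-before-max W X W<d eq′ in s′ , cong (w ∷_) X≡Ws′

factor-beside-max : ∀ {d} W X Y → Below d W → IsFactor W (X ++ d ∷ Y) → IsFactor W X ⊎ IsFactor W Y
factor-beside-max W X       Y W<d ([]    , s , eq) = let s′ , e = prefix-before-max W X W<d eq in inj₁ ([] , s′ , e)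
factor-beside-max W []      Y W<d (_ ∷ p , s , eq) = inj₂ (p , s , proj₂ (∷-injective eq))
factor-beside-max W (x ∷ X) Y W<d (_ ∷ p , s , eq)
  with factor-beside-max W X Y W<d (p , s , proj₂ (∷-injective eq))
... | inj₁ (p′ , s′ , e) = inj₁ (x ∷ p′ , s′ , cong (x ∷_) e)
... | inj₂ f             = inj₂ f

factor-around-max : ∀ {c} M L R → Below c L → Below c R → IsFactor (L ++ c ∷ R) (Z M) →
                    ∃ λ j → c ≡ suc j × IsSuffix L (Z j) × IsPrefix R (Z j)
factor-around-max zero []      R _ _ ([]    , _ , ())
factor-around-max zero (_ ∷ _) R _ _ ([]    , _ , ())
factor-around-max zero L       R _ _ (_ ∷ _ , _ , ())
factor-around-max {c} (suc M) L R L<c R<c (p , s , eq) with <-cmp c (suc M)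
... | tri≈ _ refl _ =
  let Z≡pL , Z≡Rs = Z-suc-split M (p ++ L) (R ++ s) (trans eq (++-around p L c R s))
  in M , refl , (p , Z≡pL) , (s , Z≡Rs)
... | tri< c<sM _ _
  with factor-beside-max (L ++ c ∷ R) (Z M) (Z M)
         (++⁺ (Below-mono (<⇒≤ c<sM) L<c) (c<sM ∷ Below-mono (<⇒≤ c<sM) R<c)) (p , s , eq)
...   | inj₁ f = factor-around-max M L R L<c R<c f
...   | inj₂ f = factor-around-max M L R L<c R<c f
factor-around-max {c} (suc M) L R L<c R<c (p , s , eq) | tri> _ _ sM<c =
  ⊥-elim (¬Below-max L R (Below-mono sM<c (++⁻ˡ (L ++ c ∷ R) (++⁻ʳ p (subst (Below _) eq (Z-below (suc M)))))))

factor-in-Z : ∀ j L R → Below (suc j) L → Below (suc j) R → IsPrefix R (Z j) →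
              IsFactorZ (L ++ suc j ∷ R) ⇔ IsSuffix L (Z j)
factor-in-Z j L R L<c R<c (t , Z≡Rt) = mk⇔ to from
  where
  to : IsFactorZ (L ++ suc j ∷ R) → IsSuffix L (Z j)
  to (M , f) with factor-around-max M L R L<c R<c f
  ... | _ , refl , L-suffix , _ = L-suffix
  from : IsSuffix L (Z j) → IsFactorZ (L ++ suc j ∷ R)
  from (q , Z≡qL) = suc j , q , t , (begin
    Z j ++ suc j ∷ Z j              ≡⟨ cong₂ (λ X Y → X ++ suc j ∷ Y) Z≡qL Z≡Rt ⟩
    (q ++ L) ++ suc j ∷ (R ++ t)    ≡⟨ ++-around q L (suc j) R t ⟨
    q ++ ((L ++ suc j ∷ R) ++ t)    ∎)
    where open ≡-Reasoning

×-elimˡ-⇔ : ∀ {A B : Set} → A → (A × B) ⇔ B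
×-elimˡ-⇔ a = mk⇔ proj₂ (a ,_)

suffix-Z-step : ∀ j T b → Below (suc j) T →
                IsSuffix (T ++ (if b then u (suc j) else [])) (Z (suc j)) ⇔ IsSuffix T (Z j)
suffix-Z-step j T true  T<c = begin
  IsSuffix (T ++ suc j ∷ Up j) (Z (suc j))  ≈⟨ IsSuffix-around-max T (Up j) (Z j) (Z j) (Z-below j) (Z-below j) ⟩
  (IsSuffix T (Z j) × Up j ≡ Z j)           ≈⟨ mk⇔ proj₁ (_, Up≡Z j) ⟩
  IsSuffix T (Z j)                          ∎
  where open ⇔-Reasoning
suffix-Z-step j T false T<c = begin
  IsSuffix (T ++ []) (Z (suc j))  ≡⟨ cong (λ W → IsSuffix W (Z (suc j))) (++-identityʳ T) ⟩
  IsSuffix T (Z j ++ suc j ∷ Z j) ≈⟨ IsSuffix-past-max (Z j) (Z j) T<c ⟩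
  IsSuffix T (Z j)                ∎
  where open ⇔-Reasoning

suffix-Z-descend : ∀ {n j} T A → Below (suc n) T → n ≤′ j →
                   IsSuffix (T ++ uSet A (suc j)) (Z j) ⇔ IsSuffix (T ++ uSet A (suc n)) (Z n)
suffix-Z-descend T A T<n ≤′-refl = ⇔-refl
suffix-Z-descend {n} {suc j} T A T<n (≤′-step n≤j) = begin
  IsSuffix (T ++ (uSet A (suc j) ++ X)) (Z (suc j))   ≡⟨ cong (λ W → IsSuffix W (Z (suc j))) (++-assoc T _ X) ⟨
  IsSuffix ((T ++ uSet A (suc j)) ++ X) (Z (suc j))   ≈⟨ suffix-Z-step j _ (A (suc j)) T++U<c ⟩
  IsSuffix (T ++ uSet A (suc j)) (Z j)                ≈⟨ suffix-Z-descend T A T<n n≤j ⟩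
  IsSuffix (T ++ uSet A (suc n)) (Z n)                ∎
  where
  open ⇔-Reasoning
  X = if A (suc j) then u (suc j) else []
  T++U<c : Below (suc j) (T ++ uSet A (suc j))
  T++U<c = ++⁺ (Below-mono (s≤s (≤′⇒≤ n≤j)) T<n) (uSet-below A (suc j))

suffix-vSet-step : ∀ j T b Y → Below (suc j) T →
                   IsSuffix T ((if b then v (suc j) else []) ++ Y) ⇔ IsSuffix T Y
suffix-vSet-step j T true  Y T<c = begin
  IsSuffix T (v (suc j) ++ Y)     ≡⟨ cong (IsSuffix T) (v-suc-++ j Y) ⟩
  IsSuffix T (Z j ++ suc j ∷ Y)   ≈⟨ IsSuffix-past-max (Z j) Y T<c ⟩
  IsSuffix T Y                    ∎
  where open ⇔-Reasoning
suffix-vSet-step j T false Y T<c = ⇔-refl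

suffix-vSet-descend : ∀ {n j} T B → Below (suc n) T → n ≤′ j →
                      IsSuffix T (vSet B (suc j)) ⇔ IsSuffix T (vSet B (suc n))
suffix-vSet-descend T B T<n ≤′-refl = ⇔-refl
suffix-vSet-descend {n} {suc j} T B T<n (≤′-step n≤j) = ⇔-trans
  (suffix-vSet-step j T (B (suc j)) (vSet B (suc j)) (Below-mono (s≤s (≤′⇒≤ n≤j)) T<n))
  (suffix-vSet-descend T B T<n n≤j)

suffix-Z-base : ∀ j U M → IsSuffix U (Z j) → IsSuffix (U ++ suc j ∷ M) (Z (suc j)) ⇔ (M ≡ Z j)
suffix-Z-base j U M U-suffix = ⇔-trans
  (IsSuffix-around-max U M (Z j) (Z j) (Z-below j) (Z-below j)) (×-elimˡ-⇔ U-suffix)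

suffix-vSet-base : ∀ j U V b Y → Below (suc j) Y → IsSuffix U (Z j) →
                   IsSuffix (U ++ suc j ∷ V) ((if b then v (suc j) else []) ++ Y) ⇔ (b ≡ true × V ≡ Y)
suffix-vSet-base j U V true  Y Y<c U-suffix = begin
  IsSuffix (U ++ suc j ∷ V) (v (suc j) ++ Y)      ≡⟨ cong (IsSuffix _) (v-suc-++ j Y) ⟩
  IsSuffix (U ++ suc j ∷ V) (Z j ++ suc j ∷ Y)    ≈⟨ IsSuffix-around-max U V (Z j) Y (Z-below j) Y<c ⟩
  (IsSuffix U (Z j) × V ≡ Y)                      ≈⟨ ×-elimˡ-⇔ U-suffix ⟩
  V ≡ Y                                           ≈⟨ ×-elimˡ-⇔ refl ⟨
  (true ≡ true × V ≡ Y)                           ∎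
  where open ⇔-Reasoning
suffix-vSet-base j U V false Y Y<c U-suffix = mk⇔ to λ ()
  where
  to : IsSuffix (U ++ suc j ∷ V) Y → false ≡ true × V ≡ Y
  to (p , refl) = ⊥-elim (¬Below-max U V (++⁻ʳ p Y<c))

AllCO : ℕ → (ℕ → Set) → Set
AllCO n P = ∀ i → 1 ≤ i → i < n → P i

AllCO-1 : ∀ P → AllCO 1 P
AllCO-1 P i 1≤i i<1 = ⊥-elim (<⇒≱ i<1 1≤i)

AllCO-suc : ∀ P j → AllCO (suc (suc j)) P ⇔ (P (suc j) × AllCO (suc j) P)
AllCO-suc P j = mk⇔ (λ h → h (suc j) (s≤s z≤n) ≤-refl , λ i 1≤i i<j → h i 1≤i (m<n⇒m<1+n i<j)) from
  where
  from : P (suc j) × AllCO (suc j) P → AllCO (suc (suc j)) P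
  from (Pj , h) i 1≤i i<2+j with m<1+n⇒m<n∨m≡n i<2+j
  ... | inj₁ i<1+j = h i 1≤i i<1+j
  ... | inj₂ refl  = Pj

uSet-1 : ∀ A → uSet A 1 ≡ []
uSet-1 A with A 0
... | true  = refl
... | false = refl

vSet-1 : ∀ B → vSet B 1 ≡ []
vSet-1 B with B 0
... | true  = refl
... | false = refl

Z-without-max : ∀ j M b → (M ++ (if b then u (suc j) else []) ≡ Z j) ⇔ (b ≡ false × M ≡ Z j)
Z-without-max j M true  = mk⇔ (λ eq → ⊥-elim (¬Below-max M (Up j) (subst (Below _) (sym eq) (Z-below j)))) λ ()
Z-without-max j M false = begin
  (M ++ [] ≡ Z j)           ≡⟨ cong (_≡ Z j) (++-identityʳ M) ⟩
  (M ≡ Z j)                 ≈⟨ ×-elimˡ-⇔ refl ⟨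
  (false ≡ false × M ≡ Z j) ∎
  where open ⇔-Reasoning

++-u-suc : ∀ j (VS US : Word) → VS ++ (US ++ u (suc j)) ≡ (VS ++ US) ++ suc j ∷ Z j
++-u-suc j VS US = trans (sym (++-assoc VS US (u (suc j)))) (cong (λ Y → (VS ++ US) ++ suc j ∷ Y) (Up≡Z j))

vSet++uSet-step : ∀ j b a VS US → Below (suc j) VS → Below (suc j) US →
  (((if b then v (suc j) else []) ++ VS) ++ (US ++ (if a then u (suc j) else [])) ≡ Z (suc j))
  ⇔ (b ≡ not a × VS ++ US ≡ Z j)
vSet++uSet-step j true false VS US _ _ = mk⇔
  (λ eq → refl , sym (proj₂ (Z-suc-split j (Z j) (VS ++ US) (trans (sym eq) shape))))
  (λ (_ , M≡Z) → trans shape (cong (λ Y → Z j ++ suc j ∷ Y) M≡Z))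
  where
  open ≡-Reasoning
  shape : (v (suc j) ++ VS) ++ (US ++ []) ≡ Z j ++ suc j ∷ (VS ++ US)
  shape = begin
    (v (suc j) ++ VS) ++ (US ++ [])  ≡⟨ cong (_ ++_) (++-identityʳ US) ⟩
    (v (suc j) ++ VS) ++ US          ≡⟨ ++-assoc (v (suc j)) VS US ⟩
    v (suc j) ++ (VS ++ US)          ≡⟨ v-suc-++ j (VS ++ US) ⟩
    Z j ++ suc j ∷ (VS ++ US)        ∎
vSet++uSet-step j false true VS US _ _ = mk⇔
  (λ eq → refl , sym (proj₁ (Z-suc-split j (VS ++ US) (Z j) (trans (sym eq) (++-u-suc j VS US)))))
  (λ (_ , M≡Z) → trans (++-u-suc j VS US) (cong (_++ suc j ∷ Z j) M≡Z))
vSet++uSet-step j true true VS US _ _ = mk⇔ to λ ()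
  where
  shape : (v (suc j) ++ VS) ++ (US ++ u (suc j)) ≡ Z j ++ suc j ∷ ((VS ++ US) ++ suc j ∷ Z j)
  shape = trans (++-assoc (v (suc j)) VS _) (trans (v-suc-++ j _) (cong (λ Y → Z j ++ suc j ∷ Y) (++-u-suc j VS US)))
  to : (v (suc j) ++ VS) ++ (US ++ u (suc j)) ≡ Z (suc j) → true ≡ false × _
  to eq = ⊥-elim (¬Below-max (VS ++ US) (Z j) (subst (Below _) Zj≡ (Z-below j)))
    where Zj≡ = proj₂ (Z-suc-split j (Z j) _ (trans (sym eq) shape))
vSet++uSet-step j false false VS US VS<c US<c = mk⇔ to λ ()
  where
  to : VS ++ (US ++ []) ≡ Z (suc j) → false ≡ true × _
  to eq = ⊥-elim (¬Below-max (Z j) (Z j) (subst (Below _) eq (++⁺ VS<c (++⁺ US<c []))))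

vSet++uSet≡Z : ∀ A B j → (vSet B (suc j) ++ uSet A (suc j) ≡ Z j) ⇔ AllCO (suc j) (λ i → B i ≡ not (A i))
vSet++uSet≡Z A B zero = mk⇔ (λ _ → AllCO-1 _) (λ _ → cong₂ _++_ (vSet-1 B) (uSet-1 A))
vSet++uSet≡Z A B (suc j) = begin
  (vSet B (suc (suc j)) ++ uSet A (suc (suc j)) ≡ Z (suc j))
    ≈⟨ vSet++uSet-step j (B (suc j)) (A (suc j)) _ _ (vSet-below B (suc j)) (uSet-below A (suc j)) ⟩
  (B (suc j) ≡ not (A (suc j)) × vSet B (suc j) ++ uSet A (suc j) ≡ Z j)
    ≈⟨ ⇔-refl ×-⇔ vSet++uSet≡Z A B j ⟩
  (B (suc j) ≡ not (A (suc j)) × AllCO (suc j) (λ i → B i ≡ not (A i)))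
    ≈⟨ AllCO-suc (λ i → B i ≡ not (A i)) j ⟨
  AllCO (suc (suc j)) (λ i → B i ≡ not (A i))
    ∎
  where open ⇔-Reasoning

if-v-++-injective : ∀ j b b′ X X′ → Below (suc j) X → Below (suc j) X′ →
  ((if b then v (suc j) else []) ++ X ≡ (if b′ then v (suc j) else []) ++ X′) ⇔ (b ≡ b′ × X ≡ X′)
if-v-++-injective j true  true  X X′ _ _ =
  mk⇔ (λ eq → refl , ++-cancelˡ (v (suc j)) X X′ eq) (λ (_ , X≡X′) → cong (v (suc j) ++_) X≡X′)
if-v-++-injective j false false X X′ _ _ = ⇔-sym (×-elimˡ-⇔ refl)
if-v-++-injective j true  false X X′ _ X′<c = mk⇔
  (λ eq → ⊥-elim (¬Below-max (Z j) X (subst (Below _) (trans (sym eq) (v-suc-++ j X)) X′<c))) λ ()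
if-v-++-injective j false true  X X′ X<c _ = mk⇔
  (λ eq → ⊥-elim (¬Below-max (Z j) X′ (subst (Below _) (trans eq (v-suc-++ j X′)) X<c))) λ ()

vSet-injective : ∀ B B′ j → (vSet B j ≡ vSet B′ j) ⇔ AllCO j (λ i → B i ≡ B′ i)
vSet-injective B B′ zero          = mk⇔ (λ _ i _ ()) (λ _ → refl)
vSet-injective B B′ (suc zero)    = mk⇔ (λ _ → AllCO-1 _) (λ _ → trans (vSet-1 B) (sym (vSet-1 B′)))
vSet-injective B B′ (suc (suc j)) = begin
  (vSet B (suc (suc j)) ≡ vSet B′ (suc (suc j)))
    ≈⟨ if-v-++-injective j (B (suc j)) (B′ (suc j)) _ _ (vSet-below B (suc j)) (vSet-below B′ (suc j)) ⟩
  (B (suc j) ≡ B′ (suc j) × vSet B (suc j) ≡ vSet B′ (suc j))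
    ≈⟨ ⇔-refl ×-⇔ vSet-injective B B′ (suc j) ⟩
  (B (suc j) ≡ B′ (suc j) × AllCO (suc j) (λ i → B i ≡ B′ i))
    ≈⟨ AllCO-suc (λ i → B i ≡ B′ i) j ⟨
  AllCO (suc (suc j)) (λ i → B i ≡ B′ i)
    ∎
  where open ⇔-Reasoning

reflects-true : ∀ {P : Set} {b} → Reflects P b → P → b ≡ true
reflects-true r p = det r (ofʸ p)

reflects-false : ∀ {P : Set} {b} → Reflects P b → ¬ P → b ≡ false
reflects-false r ¬p = det r (ofⁿ ¬p)

≡ᵇ-reflects-≡ : ∀ m n → Reflects (m ≡ n) (m ≡ᵇ n)
≡ᵇ-reflects-≡ m n = fromEquivalence (≡ᵇ⇒≡ m n) (≡⇒≡ᵇ m n)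

inCO-reflects : ∀ n i → Reflects (1 ≤ i × i < n) (inCO 1 n i)
inCO-reflects n i = ≤ᵇ-reflects-≤ 1 i ×-reflects <ᵇ-reflects-< i n

inOO-reflects : ∀ a b i → Reflects (a < i × i < b) (inOO a b i)
inOO-reflects a b i = <ᵇ-reflects-< a i ×-reflects <ᵇ-reflects-< i b

SubsetCO-outside : ∀ {B n i} → SubsetCO B n → ¬ (1 ≤ i × i < n) → B i ≡ false
SubsetCO-outside {B} {n} {i} B⊆ out with B i in Bi
... | true  = ⊥-elim (out (invert (subst (Reflects _) (B⊆ i Bi) (inCO-reflects n i))))
... | false = refl

AllCO-complement⇔ : ∀ n (A B : NSet) → SubsetCO B n →
  AllCO n (λ i → B i ≡ not (A i)) ⇔ (∀ i → B i ≡ (inCO 1 n i ∧ not (A i ∧ inCO 1 n i)))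
AllCO-complement⇔ n A B B⊆ = mk⇔ to from
  where
  to : AllCO n (λ i → B i ≡ not (A i)) → ∀ i → B i ≡ (inCO 1 n i ∧ not (A i ∧ inCO 1 n i))
  to h i with inCO 1 n i | inCO-reflects n i
  ... | true  | ofʸ (1≤i , i<n) = trans (h i 1≤i i<n) (cong not (sym (∧-identityʳ (A i))))
  ... | false | ofⁿ out         = SubsetCO-outside B⊆ out
  from : (∀ i → B i ≡ (inCO 1 n i ∧ not (A i ∧ inCO 1 n i))) → AllCO n (λ i → B i ≡ not (A i))
  from h i 1≤i i<n = begin
    B i                                     ≡⟨ h i ⟩
    inCO 1 n i ∧ not (A i ∧ inCO 1 n i)     ≡⟨ cong (λ x → x ∧ not (A i ∧ x)) (reflects-true (inCO-reflects n i) (1≤i , i<n)) ⟩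
    not (A i ∧ true)                        ≡⟨ cong not (∧-identityʳ (A i)) ⟩
    not (A i)                               ∎
    where open ≡-Reasoning

AllCO-agree⇔ : ∀ n (B B′ : NSet) → SubsetCO B n →
  AllCO n (λ i → B i ≡ B′ i) ⇔ (∀ i → (B′ i ∧ inCO 1 n i) ≡ B i)
AllCO-agree⇔ n B B′ B⊆ = mk⇔ to from
  where
  to : AllCO n (λ i → B i ≡ B′ i) → ∀ i → (B′ i ∧ inCO 1 n i) ≡ B i
  to h i with inCO 1 n i | inCO-reflects n i
  ... | true  | ofʸ (1≤i , i<n) = trans (∧-identityʳ (B′ i)) (sym (h i 1≤i i<n))
  ... | false | ofⁿ out         = trans (∧-zeroʳ (B′ i)) (sym (SubsetCO-outside B⊆ out))
  from : (∀ i → (B′ i ∧ inCO 1 n i) ≡ B i) → AllCO n (λ i → B i ≡ B′ i)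
  from h i 1≤i i<n = begin
    B i                 ≡⟨ h i ⟨
    B′ i ∧ inCO 1 n i   ≡⟨ cong (B′ i ∧_) (reflects-true (inCO-reflects n i) (1≤i , i<n)) ⟩
    B′ i ∧ true         ≡⟨ ∧-identityʳ (B′ i) ⟩
    B′ i                ∎
    where open ≡-Reasoning

uSet-cong : ∀ A A′ n → (∀ i → i < n → A i ≡ A′ i) → uSet A n ≡ uSet A′ n
uSet-cong A A′ zero    eq = refl
uSet-cong A A′ (suc n) eq =
  cong₂ (λ W b → W ++ (if b then u n else [])) (uSet-cong A A′ n (λ i i<n → eq i (m<n⇒m<1+n i<n))) (eq n ≤-refl)

uSet-extend : ∀ {n j} A A′ w → n ≤′ j → (∀ i → n < i → i ≤ j → A i ≡ A′ i) →
              uSet A (suc n) ≡ w ++ uSet A′ (suc n) → uSet A (suc j) ≡ w ++ uSet A′ (suc j)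
uSet-extend A A′ w ≤′-refl agree base = base
uSet-extend {n} {suc j} A A′ w (≤′-step n≤j) agree base = begin
  uSet A (suc j) ++ (if A (suc j) then u (suc j) else [])
    ≡⟨ cong₂ (λ W b → W ++ (if b then u (suc j) else []))
             (uSet-extend A A′ w n≤j (λ i n<i i≤j → agree i n<i (m≤n⇒m≤1+n i≤j)) base)
             (agree (suc j) (s≤s (≤′⇒≤ n≤j)) ≤-refl) ⟩
  (w ++ uSet A′ (suc j)) ++ (if A′ (suc j) then u (suc j) else [])
    ≡⟨ ++-assoc w _ _ ⟩
  w ++ uSet A′ (suc (suc j))
    ∎
  where open ≡-Reasoning

module Criteria (n′ m′ : ℕ) (n≤m′ : suc n′ ≤′ m′) (A₁ B₁ A₂ B₂ : NSet)
                (A₁⊆ : SubsetCO A₁ (suc n′)) (B₁⊆ : SubsetCO B₁ (suc n′))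
                (U₁-suffix : IsSuffix (uSet A₁ (suc n′)) (Z n′))
                (V₂-prefix : IsPrefix (vSet B₂ (suc m′)) (Z m′)) where

  n m : ℕ
  n = suc n′
  m = suc m′

  U₁ V₁ U₂ V₂ w₁ w₂ : Word
  U₁ = uSet A₁ n
  V₁ = vSet B₁ n
  U₂ = uSet A₂ m
  V₂ = vSet B₂ m
  w₁ = rep A₁ n B₁
  w₂ = rep A₂ m B₂

  n<m : n < m
  n<m = s≤s (≤′⇒≤ n≤m′)

  w₁-below : Below (suc n) w₁
  w₁-below = ++⁺ (Below-mono (n≤1+n n) (uSet-below A₁ n)) (n<1+n n ∷ Below-mono (n≤1+n n) (vSet-below B₁ n))

  factor⇔ : IsFactorZ (w₁ ++ w₂) ⇔ (A₂ n ≡ false × V₁ ++ uSet A₂ n ≡ Z n′)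
  factor⇔ = begin
    IsFactorZ (w₁ ++ w₂)
      ≡⟨ cong IsFactorZ (++-assoc w₁ U₂ (m ∷ V₂)) ⟨
    IsFactorZ ((w₁ ++ U₂) ++ m ∷ V₂)
      ≈⟨ factor-in-Z m′ (w₁ ++ U₂) V₂ (++⁺ (Below-mono n<m w₁-below) (uSet-below A₂ m)) (vSet-below B₂ m) V₂-prefix ⟩
    IsSuffix (w₁ ++ U₂) (Z m′)
      ≈⟨ suffix-Z-descend w₁ A₂ w₁-below n≤m′ ⟩
    IsSuffix (w₁ ++ uSet A₂ (suc n)) (Z n)
      ≡⟨ cong (λ W → IsSuffix W (Z n)) (++-assoc U₁ (n ∷ V₁) _) ⟩
    IsSuffix (U₁ ++ n ∷ (V₁ ++ uSet A₂ (suc n))) (Z n)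
      ≈⟨ suffix-Z-base n′ U₁ _ U₁-suffix ⟩
    (V₁ ++ uSet A₂ (suc n) ≡ Z n′)
      ≡⟨ cong (_≡ Z n′) (++-assoc V₁ (uSet A₂ n) _) ⟨
    ((V₁ ++ uSet A₂ n) ++ (if A₂ n then u n else []) ≡ Z n′)
      ≈⟨ Z-without-max n′ _ (A₂ n) ⟩
    (A₂ n ≡ false × V₁ ++ uSet A₂ n ≡ Z n′)
      ∎
    where open ⇔-Reasoning

  factor-criterion :
    IsFactorZ (w₁ ++ w₂) ⇔ (A₂ n ≡ false × (∀ i → B₁ i ≡ (inCO 1 n i ∧ not (A₂ i ∧ inCO 1 n i))))
  factor-criterion =
    ⇔-trans factor⇔ (⇔-refl ×-⇔ ⇔-trans (vSet++uSet≡Z A₂ B₁ n′) (AllCO-complement⇔ n A₂ B₁ B₁⊆))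

  A′ : NSet
  A′ i = A₁ i ∨ (i ≡ᵇ n) ∨ (A₂ i ∧ inOO n m i)

  A′-below : ∀ i → i < n → A′ i ≡ A₁ i
  A′-below i i<n = begin
    A₁ i ∨ (i ≡ᵇ n) ∨ (A₂ i ∧ inOO n m i)
      ≡⟨ cong₂ (λ x y → A₁ i ∨ x ∨ (A₂ i ∧ y))
               (reflects-false (≡ᵇ-reflects-≡ i n) (<⇒≢ i<n))
               (reflects-false (inOO-reflects n m i) (λ (n<i , _) → <-asym i<n n<i)) ⟩
    A₁ i ∨ (A₂ i ∧ false)  ≡⟨ cong (A₁ i ∨_) (∧-zeroʳ (A₂ i)) ⟩
    A₁ i ∨ false           ≡⟨ ∨-identityʳ (A₁ i) ⟩
    A₁ i                   ∎
    where open ≡-Reasoning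

  A′-at : A′ n ≡ true
  A′-at = trans (cong (λ x → A₁ n ∨ x ∨ (A₂ n ∧ inOO n m n)) (reflects-true (≡ᵇ-reflects-≡ n n) refl))
                (∨-zeroʳ (A₁ n))

  A′-above : ∀ i → n < i → i ≤ m′ → A′ i ≡ A₂ i
  A′-above i n<i i≤m′ = begin
    A₁ i ∨ (i ≡ᵇ n) ∨ (A₂ i ∧ inOO n m i)
      ≡⟨ cong₂ (λ x y → x ∨ y ∨ (A₂ i ∧ inOO n m i))
               (SubsetCO-outside A₁⊆ (λ (_ , i<n) → <-asym i<n n<i))
               (reflects-false (≡ᵇ-reflects-≡ i n) (<⇒≢ n<i ∘ sym)) ⟩
    A₂ i ∧ inOO n m i
      ≡⟨ cong (A₂ i ∧_) (reflects-true (inOO-reflects n m i) (n<i , s≤s i≤m′)) ⟩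
    A₂ i ∧ true
      ≡⟨ ∧-identityʳ (A₂ i) ⟩
    A₂ i
      ∎
    where open ≡-Reasoning

  factor-shape : IsFactorZ (w₁ ++ w₂) → w₁ ++ w₂ ≡ rep A′ m B₂
  factor-shape factor = begin
    w₁ ++ (U₂ ++ m ∷ V₂)  ≡⟨ ++-assoc w₁ U₂ (m ∷ V₂) ⟨
    (w₁ ++ U₂) ++ m ∷ V₂  ≡⟨ cong (_++ m ∷ V₂) (uSet-extend A′ A₂ w₁ n≤m′ A′-above up-to-n) ⟨
    uSet A′ m ++ m ∷ V₂   ∎
    where
    open ≡-Reasoning
    A₂n≡false = proj₁ (Equivalence.to factor⇔ factor)
    V₁U≡Z = proj₂ (Equivalence.to factor⇔ factor)
    up-to-n : uSet A′ (suc n) ≡ w₁ ++ uSet A₂ (suc n)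
    up-to-n = begin
      uSet A′ n ++ (if A′ n then u n else [])
        ≡⟨ cong₂ (λ W b → W ++ (if b then u n else [])) (uSet-cong A′ A₁ n A′-below) A′-at ⟩
      U₁ ++ n ∷ Up n′                        ≡⟨ cong (λ Y → U₁ ++ n ∷ Y) (trans (Up≡Z n′) (sym V₁U≡Z)) ⟩
      U₁ ++ n ∷ (V₁ ++ uSet A₂ n)            ≡⟨ ++-assoc U₁ (n ∷ V₁) _ ⟨
      w₁ ++ uSet A₂ n                        ≡⟨ cong (w₁ ++_) (++-identityʳ (uSet A₂ n)) ⟨
      w₁ ++ (uSet A₂ n ++ [])
        ≡⟨ cong (λ b → w₁ ++ (uSet A₂ n ++ (if b then u n else []))) A₂n≡false ⟨
      w₁ ++ uSet A₂ (suc n)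
        ∎

  suffix-criterion : IsSuffix w₁ w₂ ⇔ (B₂ n ≡ true × (∀ i → (B₂ i ∧ inCO 1 n i) ≡ B₁ i))
  suffix-criterion = begin
    IsSuffix w₁ (U₂ ++ m ∷ V₂)
      ≈⟨ IsSuffix-past-max U₂ V₂ (Below-mono n<m w₁-below) ⟩
    IsSuffix w₁ V₂
      ≈⟨ suffix-vSet-descend w₁ B₂ w₁-below n≤m′ ⟩
    IsSuffix w₁ (vSet B₂ (suc n))
      ≈⟨ suffix-vSet-base n′ U₁ V₁ (B₂ n) (vSet B₂ n) (vSet-below B₂ n) U₁-suffix ⟩
    (B₂ n ≡ true × V₁ ≡ vSet B₂ n)
      ≈⟨ ⇔-refl ×-⇔ ⇔-trans (vSet-injective B₁ B₂ n) (AllCO-agree⇔ n B₁ B₂ B₁⊆) ⟩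
    (B₂ n ≡ true × (∀ i → (B₂ i ∧ inCO 1 n i) ≡ B₁ i))
      ∎
    where open ⇔-Reasoning

Concatenation : (w₁ w₂ : Word) (A₁ B₁ A₂ B₂ : NSet) (n m : ℕ) → Set
Concatenation w₁ w₂ A₁ B₁ A₂ B₂ n m =
  (IsFactorZ (w₁ ++ w₂) ⇔ (A₂ n ≡ false × (∀ i → B₁ i ≡ (inCO 1 n i ∧ not (A₂ i ∧ inCO 1 n i)))))
  × (IsFactorZ (w₁ ++ w₂) → w₁ ++ w₂ ≡ rep (λ i → A₁ i ∨ (i ≡ᵇ n) ∨ (A₂ i ∧ inOO n m i)) m B₂)
  × (IsSuffix w₁ w₂ ⇔ (B₂ n ≡ true × (∀ i → (B₂ i ∧ inCO 1 n i) ≡ B₁ i)))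

concatenation : ∀ A₁ B₁ A₂ B₂ n m → IsFactorZ (rep A₁ n B₁) → IsFactorZ (rep A₂ m B₂) → n < m →
                SubsetCO A₁ n → SubsetCO B₁ n → Concatenation (rep A₁ n B₁) (rep A₂ m B₂) A₁ B₁ A₂ B₂ n m
concatenation A₁ B₁ A₂ B₂ n m (M₁ , factor₁) (M₂ , factor₂) n<m A₁⊆ B₁⊆
  with factor-around-max M₁ (uSet A₁ n) (vSet B₁ n) (uSet-below A₁ n) (vSet-below B₁ n) factor₁
     | factor-around-max M₂ (uSet A₂ m) (vSet B₂ m) (uSet-below A₂ m) (vSet-below B₂ m) factor₂
... | n′ , refl , U₁-suffix , _ | m′ , refl , _ , V₂-prefix = factor-criterion , factor-shape , suffix-criterion
  where open Criteria n′ m′ (≤⇒≤′ (≤-pred n<m)) A₁ B₁ A₂ B₂ A₁⊆ B₁⊆ U₁-suffix V₂-prefix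

proposition9 :
    (w₁ w₂ : Word) (A₁ B₁ A₂ B₂ : NSet) →
    IsFactorZ w₁ → IsFactorZ w₂ → k w₁ < k w₂ →
    SubsetCO A₁ (k w₁) → SubsetCO B₁ (k w₁) →
    SubsetCO A₂ (k w₂) → SubsetCO B₂ (k w₂) →
    w₁ ≡ rep A₁ (k w₁) B₁ → w₂ ≡ rep A₂ (k w₂) B₂ →
    (IsFactorZ (w₁ ++ w₂) ⇔
       (A₂ (k w₁) ≡ false ×
        (∀ i → B₁ i ≡ (inCO 1 (k w₁) i ∧ not (A₂ i ∧ inCO 1 (k w₁) i)))))
    × (IsFactorZ (w₁ ++ w₂) →
       w₁ ++ w₂ ≡ rep (λ i → A₁ i ∨ (i ≡ᵇ k w₁) ∨ (A₂ i ∧ inOO (k w₁) (k w₂) i))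
                      (k w₂) B₂)
    × (IsSuffix w₁ w₂ ⇔
       (B₂ (k w₁) ≡ true × (∀ i → (B₂ i ∧ inCO 1 (k w₁) i) ≡ B₁ i)))
proposition9 w₁ w₂ A₁ B₁ A₂ B₂ factor₁ factor₂ n<m A₁⊆ B₁⊆ _ _ w₁≡ w₂≡ =
  subst₂ (λ x y → Concatenation x y A₁ B₁ A₂ B₂ (k w₁) (k w₂)) (sym w₁≡) (sym w₂≡)
    (concatenation A₁ B₁ A₂ B₂ (k w₁) (k w₂) (subst IsFactorZ w₁≡ factor₁) (subst IsFactorZ w₂≡ factor₂)
                   n<m A₁⊆ B₁⊆)
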